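{- Let $m,n\ge1$ and let $\phi$ be a closed 90-degree trail at a vertex of the grid graph $G_{m\times n}$, viewed inside the rectangle $R=[0,m+1]\times[0,n+1]$. Then the regions into which $\phi$ separates $R$ admit a proper labeling in which all unbounded regions are negative.
   Context: $G_{m\times n}=P_m\square P_n$ is the grid graph with vertex set $[m]\times[n]$, $(i,j)\sim(i',j')$ iff $|i-i'|+|j-j'|=1$, embedded in $R=[0,m+1]\times[0,n+1]$. A ray from a vertex $v$ leaves $v$ in one of the four diagonal directions $(\pm1,\pm1)$ and travels in a straight line, reflecting off the sides of $R$ in the usual manner; it stops when it hits a corner of $R$ or returns to $v$. A trail at $v$ is the collection of straight line segments traced by a single ray from $v$ or by two rays from $v$ in different directions. Only trails with exactly two straight line segments touching $v$ are considered; such a trail is a 90-degree trail if these two segments meet at a right angle at $v$. A trail is open if both of its ends go to corners of $R$, and closed otherwise. A trail separates $R$ into disjoint regions; a region is unbounded if part of its boundary is a part of a side of $R$. A labeling assigns to each region the label positive or negative; it is proper if any two regions that share a side have different labels. -}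

module Defs where

open import Data.Nat using (ℕ; zero; suc; pred; _≤_; _≡ᵇ_)
open import Data.Bool using (Bool; true; false; not; _xor_; if_then_else_)
open import Data.Product using (Σ; ∃; _×_; _,_; proj₁; proj₂)
open import Data.Sum using (_⊎_)
open import Data.Empty using (⊥)
open import Relation.Binary.PropositionalEquality using (_≡_; _≢_)
open import Relation.Nullary using (¬_)
open import Relation.Binary.Construct.Closure.ReflexiveTransitive using (Star)

-- The rectangle is R = [0,m+1] × [0,n+1]; lattice points are pairs of
-- naturals.  The grid vertices are (i,j) with 1 ≤ i ≤ m, 1 ≤ j ≤ n.
-- A direction (±1,±1) is a pair of Booleans (true = +1, false = -1).

Point : Set
Point = ℕ × ℕ

Dir : Set
Dir = Bool × Bool

-- A unit diagonal segment: the unit square [a,a+1]×[b,b+1] together with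
-- which of its diagonals; true = "main" diagonal (a,b)–(a+1,b+1),
-- false = "anti" diagonal (a+1,b)–(a,b+1).
-- Every ray segment is a union of such unit diagonals.
Seg : Set
Seg = ℕ × ℕ × Bool

record State : Set where
  constructor st
  field
    x y : ℕ
    dx dy : Bool

stepC : Bool → ℕ → ℕ
stepC true  x = suc x
stepC false x = pred x

reflectDir : ℕ → ℕ → Bool → Bool
reflectDir M x d = if x ≡ᵇ 0 then true else (if x ≡ᵇ M then false else d)

move : ℕ → ℕ → State → State
move m n (st x y dx dy) =
  st (stepC dx x) (stepC dy y)
     (reflectDir (suc m) (stepC dx x) dx)
     (reflectDir (suc n) (stepC dy y) dy)

iter : ℕ → (State → State) → State → State
iter zero    f s = s
iter (suc k) f s = f (iter k f s)

posOf : State → Point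
posOf (st x y _ _) = x , y

-- the unit diagonal traversed when leaving the given state
segOf : State → Seg
segOf (st x y dx dy) =
  (if dx then x else pred x) , (if dy then y else pred y) , not (dx xor dy)

IsCorner : ℕ → ℕ → Point → Set
IsCorner m n (x , y) = (x ≡ 0 ⊎ x ≡ suc m) × (y ≡ 0 ⊎ y ≡ suc n)

stateAt : ℕ → ℕ → Point → Dir → ℕ → State
stateAt m n (vx , vy) (ex , ey) k = iter k (move m n) (st vx vy ex ey)

posAt : ℕ → ℕ → Point → Dir → ℕ → Point
posAt m n v d k = posOf (stateAt m n v d k)

-- the ray from v in direction d has not stopped during its first k steps
-- (it stops when it hits a corner of R or returns to v)
Alive : ℕ → ℕ → Point → Dir → ℕ → Set
Alive m n v d k =
  ∀ j → 1 ≤ j → j ≤ k → ¬ IsCorner m n (posAt m n v d j) × posAt m n v d j ≢ v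

InRay : ℕ → ℕ → Point → Dir → Seg → Set
InRay m n v d s = ∃ λ k → Alive m n v d k × segOf (stateAt m n v d k) ≡ s

ReachesCorner : ℕ → ℕ → Point → Dir → Set
ReachesCorner m n v d = ∃ λ k → Alive m n v d k × IsCorner m n (posAt m n v d (suc k))

data TrailSpec : Set where
  oneRay  : Dir → TrailSpec
  twoRays : (d₁ d₂ : Dir) → d₁ ≢ d₂ → TrailSpec

TrailSeg : ℕ → ℕ → Point → TrailSpec → Seg → Set
TrailSeg m n v (oneRay d)         s = InRay m n v d s
TrailSeg m n v (twoRays d₁ d₂ _)  s = InRay m n v d₁ s ⊎ InRay m n v d₂ s

-- open: both ends go to corners (a single-ray trail has v as an end)
OpenTrail : ℕ → ℕ → Point → TrailSpec → Set
OpenTrail m n v (oneRay d)        = ⊥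
OpenTrail m n v (twoRays d₁ d₂ _) = ReachesCorner m n v d₁ × ReachesCorner m n v d₂

Touches : Point → Seg → Set
Touches p (a , b , true)  = p ≡ (a , b) ⊎ p ≡ (suc a , suc b)
Touches p (a , b , false) = p ≡ (suc a , b) ⊎ p ≡ (a , suc b)

-- exactly two segments of the trail touch v, and they meet at a right
-- angle at v (two distinct unit diagonals through v are perpendicular iff
-- they are of different diagonal type)
NinetyDegree : ℕ → ℕ → Point → TrailSpec → Set
NinetyDegree m n v τ =
  Σ Seg λ s₁ → Σ Seg λ s₂ →
    s₁ ≢ s₂ ×
    TrailSeg m n v τ s₁ × Touches v s₁ ×
    TrailSeg m n v τ s₂ × Touches v s₂ ×
    (∀ s → TrailSeg m n v τ s → Touches v s → s ≡ s₁ ⊎ s ≡ s₂) ×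
    proj₂ (proj₂ s₁) ≢ proj₂ (proj₂ s₂)

ClosedNinetyDegreeTrail : ℕ → ℕ → Point → TrailSpec → Set
ClosedNinetyDegreeTrail m n v τ = NinetyDegree m n v τ × ¬ OpenTrail m n v τ

-- Each unit square [a,a+1]×[b,b+1] (a ≤ m, b ≤ n) is cut by
-- both its diagonals into four open triangles (north/east/south/west).
-- Since the trail is a union of unit diagonals, the regions of R are
-- exactly the classes of triangles connected through edges not on the trail.

data Side : Set where
  north east south west : Side

Tri : Set
Tri = ℕ × ℕ × Side

ValidTri : ℕ → ℕ → Tri → Set
ValidTri m n (a , b , _) = a ≤ m × b ≤ n

-- two triangles of one square sharing a half of the given diagonal
data HalfDiag : Side → Side → Bool → Set where
  se : HalfDiag south east false
  es : HalfDiag east south false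
  en : HalfDiag east north true
  ne : HalfDiag north east true
  nw : HalfDiag north west false
  wn : HalfDiag west north false
  ws : HalfDiag west south true
  sw : HalfDiag south west true

data Free (m n : ℕ) (T : Seg → Set) : Tri → Tri → Set where
  inner : ∀ {a b s t d} → a ≤ m → b ≤ n → HalfDiag s t d → ¬ T (a , b , d) →
          Free m n T (a , b , s) (a , b , t)
  up    : ∀ {a b} → a ≤ m → suc b ≤ n → Free m n T (a , b , north) (a , suc b , south)
  down  : ∀ {a b} → a ≤ m → suc b ≤ n → Free m n T (a , suc b , south) (a , b , north)
  right : ∀ {a b} → suc a ≤ m → b ≤ n → Free m n T (a , b , east) (suc a , b , west)
  left  : ∀ {a b} → suc a ≤ m → b ≤ n → Free m n T (suc a , b , west) (a , b , east)

data Cut (m n : ℕ) (T : Seg → Set) : Tri → Tri → Set where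
  cut : ∀ {a b s t d} → a ≤ m → b ≤ n → HalfDiag s t d → T (a , b , d) →
        Cut m n T (a , b , s) (a , b , t)

SameRegion : ℕ → ℕ → (Seg → Set) → Tri → Tri → Set
SameRegion m n T = Star (Free m n T)

OnBoundary : ℕ → ℕ → Tri → Set
OnBoundary m n (a , b , south) = b ≡ 0
OnBoundary m n (a , b , north) = b ≡ n
OnBoundary m n (a , b , west)  = a ≡ 0
OnBoundary m n (a , b , east)  = a ≡ m

InUnboundedRegion : ℕ → ℕ → (Seg → Set) → Tri → Set
InUnboundedRegion m n T t =
  ∃ λ u → ValidTri m n u × OnBoundary m n u × SameRegion m n T t u

-- labeling (true = positive, false = negative) of triangles, constant on
-- regions (i.e. a labeling of regions); proper; unbounded regions negative
ProperNegativeLabeling : ℕ → ℕ → (Seg → Set) → (Tri → Bool) → Set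
ProperNegativeLabeling m n T ℓ =
  (∀ t u → SameRegion m n T t u → ℓ t ≡ ℓ u) ×
  (∀ t u → Cut m n T t u → ¬ SameRegion m n T t u → ℓ t ≢ ℓ u) ×
  (∀ t → ValidTri m n t → InUnboundedRegion m n T t → ℓ t ≡ false)

-- The two coordinates of a ray bounce independently and periodically in [0, m+1] and [0, n+1],
-- so a ray from v either returns to v or reaches a corner.  Hence every ray of a closed 90-degree
-- trail returns to v: when there are two rays, the last segment of one is the first segment of the
-- other (a ray never retraces itself), so the second ray is the first one traversed backwards.
-- A returning ray passes straight through or is reflected at every lattice point other than v,
-- never meets a corner, and uses exactly one diagonal of each slope at v; so at every lattice
-- point of R an even number of trail diagonals meet.  Labelling each triangle by the parity of
-- the trail diagonals crossed on the way up from the bottom side of R is then consistent across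
-- every edge off the trail, flips across every edge on it, and is negative along the sides of R.

{-# OPTIONS --safe #-}
module Submission where

open import Defs
open import Data.Nat using (ℕ; zero; suc; pred; _≤_; _+_; _*_; _∸_; _≡ᵇ_; z≤n; s≤s; _≟_)
open import Data.Nat.Properties
  using ( ≤-refl; ≤-reflexive; ≤-trans; ≤-pred; <⇒≤; <⇒≢; ≤∧≢⇒<; 1+n≢n; m≤n⇒m<n∨m≡n; ≤-<-connex
        ; suc-injective; +-suc; +-comm; +-identityʳ; *-comm; m+[n∸m]≡n; ∸-monoʳ-<; m≤m+n; anyUpTo? )
open import Data.Bool using (Bool; true; false; not; _xor_; if_then_else_)
import Data.Bool as Bool
open import Data.Bool.Properties
  using (if-eta; not-¬; not-involutive; xor-assoc; xor-comm; xor-same; xor-identityʳ; xor-annihilates-not)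
open import Data.Product using (∃; _×_; _,_; proj₁; proj₂)
open import Data.Product.Properties using (≡-dec)
open import Data.Sum using (_⊎_; inj₁; inj₂; [_,_]′; swap)
open import Function using (_∘_)
open import Function.Bundles using (mk⇔)
open import Relation.Binary.Construct.Closure.ReflexiveTransitive using (ε; _◅_)
open import Relation.Binary.PropositionalEquality
open import Relation.Nullary using (¬_; Dec; yes; no; does; contradiction)
open import Relation.Nullary.Decidable using (dec-true; dec-false; does-⇔; _⊎-dec_; _×-dec_; map′)

iterate : {A : Set} → (A → A) → ℕ → A → A
iterate f zero    a = a
iterate f (suc k) a = f (iterate f k a)

iterate-+ : {A : Set} (f : A → A) (j k : ℕ) (a : A) →
            iterate f (j + k) a ≡ iterate f j (iterate f k a)
iterate-+ f zero    k a = refl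
iterate-+ f (suc j) k a = cong f (iterate-+ f j k a)

iterate-comm : {A : Set} (f : A → A) (j k : ℕ) (a : A) →
               iterate f j (iterate f k a) ≡ iterate f k (iterate f j a)
iterate-comm f j k a = begin
  iterate f j (iterate f k a) ≡⟨ sym (iterate-+ f j k a) ⟩
  iterate f (j + k) a         ≡⟨ cong (λ i → iterate f i a) (+-comm j k) ⟩
  iterate f (k + j) a         ≡⟨ iterate-+ f k j a ⟩
  iterate f k (iterate f j a) ∎
  where open ≡-Reasoning

iterate-*-fixed : {A : Set} (f : A → A) (c p : ℕ) (a : A) →
                  iterate f p a ≡ a → iterate f (c * p) a ≡ a
iterate-*-fixed f zero    p a fix = refl
iterate-*-fixed f (suc c) p a fix = begin
  iterate f (p + c * p) a         ≡⟨ iterate-+ f p (c * p) a ⟩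
  iterate f p (iterate f (c * p) a) ≡⟨ cong (iterate f p) (iterate-*-fixed f c p a fix) ⟩
  iterate f p a                   ≡⟨ fix ⟩
  a                               ∎
  where open ≡-Reasoning

-- Billiard motion of one coordinate in [0, m+1]

bounce : ℕ → ℕ × Bool → ℕ × Bool
bounce m (x , e) = stepC e x , reflectDir (suc m) (stepC e x) e

data Valid (m : ℕ) : ℕ × Bool → Set where
  up   : ∀ {x} → x ≤ m → Valid m (x , true)
  down : ∀ {x} → x ≤ m → Valid m (suc x , false)

-- the direction in which a ball that arrived at x moving against e leaves x
turnDir : ℕ → ℕ → Bool → Bool
turnDir M x e = reflectDir M x (not e)

reflectDir-top : ∀ m e → reflectDir (suc m) (suc m) e ≡ false
reflectDir-top m e rewrite dec-true (m ≟ m) refl = refl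

reflectDir-inner : ∀ {m x} e → x ≢ m → reflectDir (suc m) (suc x) e ≡ e
reflectDir-inner {m} {x} e x≢m rewrite dec-false (x ≟ m) x≢m = refl

reflectDir-flip : ∀ M x e → reflectDir M x e ≡ not e → x ≡ 0 ⊎ x ≡ M
reflectDir-flip M zero    e _ = inj₁ refl
reflectDir-flip M (suc x) e h with suc x ≟ M
... | yes x≡M = inj₂ x≡M
... | no  x≢M rewrite dec-false (suc x ≟ M) x≢M = contradiction h (not-¬ refl)

bounce-valid : ∀ {m p} → Valid m p → Valid m (bounce m p)
bounce-valid {m} (up {x} x≤m) with x ≟ m
... | yes refl rewrite reflectDir-top m true = down ≤-refl
... | no  x≢m  rewrite reflectDir-inner true x≢m = up (≤∧≢⇒< x≤m x≢m)
bounce-valid         (down {zero}  _)   = up z≤n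
bounce-valid {m}     (down {suc x} x<m) rewrite if-eta (x ≡ᵇ m) {false} = down (<⇒≤ x<m)

reverse₁ : ℕ × Bool → ℕ × Bool
reverse₁ (x , e) = stepC e x , not e

stepC-inverse : ∀ {m x e} → Valid m (x , e) → stepC (not e) (stepC e x) ≡ x
stepC-inverse (up _)   = refl
stepC-inverse (down _) = refl

stepC-moves : ∀ {m x e} → Valid m (x , e) → stepC e x ≢ x
stepC-moves (up _)   = 1+n≢n
stepC-moves (down _) = 1+n≢n ∘ sym

turnDir-bounce : ∀ {m x e} → Valid m (x , e) →
                 let x′ = stepC e x in turnDir (suc m) x′ (reflectDir (suc m) x′ e) ≡ not e
turnDir-bounce {m} (up {x} x≤m) with x ≟ m
... | yes refl rewrite reflectDir-top m true | reflectDir-top m true = refl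
... | no  x≢m  rewrite reflectDir-inner true x≢m | reflectDir-inner false x≢m = refl
turnDir-bounce (down {zero} _) = refl
turnDir-bounce (down {suc x} x<m)
  rewrite reflectDir-inner false (<⇒≢ x<m) | reflectDir-inner true (<⇒≢ x<m) = refl

turnDir-valid : ∀ {m x e} → Valid m (x , e) → Valid m (x , turnDir (suc m) x e)
turnDir-valid (up {zero} _) = up z≤n
turnDir-valid {m} (up {suc x} x<m) rewrite reflectDir-inner false (<⇒≢ x<m) = down (<⇒≤ x<m)
turnDir-valid {m} (down {x} x≤m) with x ≟ m
... | yes refl rewrite reflectDir-top m true = down x≤m
... | no  x≢m  rewrite reflectDir-inner true x≢m = up (≤∧≢⇒< x≤m x≢m)

turnDir-involutive : ∀ {m x e} → Valid m (x , e) → turnDir (suc m) x (turnDir (suc m) x e) ≡ e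
turnDir-involutive (up {zero} _) = refl
turnDir-involutive (up {suc x} x<m)
  rewrite reflectDir-inner false (<⇒≢ x<m) | reflectDir-inner true (<⇒≢ x<m) = refl
turnDir-involutive {m} (down {x} x≤m) with x ≟ m
... | yes refl rewrite reflectDir-top m true | reflectDir-top m true = refl
... | no  x≢m  rewrite reflectDir-inner true x≢m | reflectDir-inner false x≢m = refl

lowEnd : ℕ × Bool → ℕ
lowEnd (x , e) = if e then x else pred x

lowEnd-injective : ∀ {m p q} → Valid m p → Valid m q → lowEnd p ≡ lowEnd q →
                   q ≡ p ⊎ q ≡ reverse₁ p
lowEnd-injective (up _)   (up _)   refl = inj₁ refl
lowEnd-injective (down _) (down _) refl = inj₁ refl
lowEnd-injective (up _)   (down _) refl = inj₂ refl
lowEnd-injective (down _) (up _)   refl = inj₂ refl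

climb : ∀ m j → j ≤ m → iterate (bounce m) j (0 , true) ≡ (j , true)
climb m zero    _   = refl
climb m (suc j) j<m rewrite climb m j (<⇒≤ j<m) | reflectDir-inner true (<⇒≢ j<m) = refl

fall : ∀ m y j → y + j ≤ m → iterate (bounce m) j (suc (y + j) , false) ≡ (suc y , false)
fall m y zero    _ rewrite +-identityʳ y = refl
fall m y (suc j) h rewrite +-suc y j | fall m (suc y) j h =
  cong (suc y ,_) (if-eta (y ≡ᵇ m))

reach-top : ∀ m → iterate (bounce m) (suc m) (0 , true) ≡ (suc m , false)
reach-top m rewrite climb m m ≤-refl | reflectDir-top m true = refl

reach-bottom : ∀ m → iterate (bounce m) (suc m) (suc m , false) ≡ (0 , true)
reach-bottom m = cong (bounce m) (fall m 0 m ≤-refl)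

bounce-period : ∀ m → iterate (bounce m) (suc m + suc m) (0 , true) ≡ (0 , true)
bounce-period m = begin
  iterate f (suc m + suc m) (0 , true)             ≡⟨ iterate-+ f (suc m) (suc m) _ ⟩
  iterate f (suc m) (iterate f (suc m) (0 , true)) ≡⟨ cong (iterate f (suc m)) (reach-top m) ⟩
  iterate f (suc m) (suc m , false)                ≡⟨ reach-bottom m ⟩
  (0 , true)                                       ∎
  where
  open ≡-Reasoning
  f : ℕ × Bool → ℕ × Bool
  f = bounce m

bounce-orbit : ∀ {m p} → Valid m p → ∃ λ j → iterate (bounce m) j (0 , true) ≡ p
bounce-orbit {m} (up {x} x≤m)   = x , climb m x x≤m
bounce-orbit {m} (down {x} x≤m) = m ∸ x + suc m , (begin
  iterate f (m ∸ x + suc m) (0 , true)             ≡⟨ iterate-+ f (m ∸ x) (suc m) _ ⟩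
  iterate f (m ∸ x) (iterate f (suc m) (0 , true)) ≡⟨ cong (iterate f (m ∸ x)) (reach-top m) ⟩
  iterate f (m ∸ x) (suc m , false)                ≡⟨ cong (λ k → iterate f (m ∸ x) (suc k , false)) (sym x+[m∸x]) ⟩
  iterate f (m ∸ x) (suc (x + (m ∸ x)) , false)    ≡⟨ fall m x (m ∸ x) (≤-reflexive x+[m∸x]) ⟩
  (suc x , false)                                  ∎)
  where
  open ≡-Reasoning
  f : ℕ × Bool → ℕ × Bool
  f = bounce m
  x+[m∸x] : x + (m ∸ x) ≡ m
  x+[m∸x] = m+[n∸m]≡n x≤m

bounce-periodic : ∀ {m p} → Valid m p → iterate (bounce m) (suc m + suc m) p ≡ p
bounce-periodic {m} vp with bounce-orbit vp
... | j , refl = trans (iterate-comm (bounce m) (suc m + suc m) j _)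
                       (cong (iterate (bounce m) j) (bounce-period m))

-- Rays

xPart yPart : State → ℕ × Bool
xPart (st x y dx dy) = x , dx
yPart (st x y dx dy) = y , dy

fromParts : ℕ × Bool → ℕ × Bool → State
fromParts (x , dx) (y , dy) = st x y dx dy

ValidState : ℕ → ℕ → State → Set
ValidState m n s = Valid m (xPart s) × Valid n (yPart s)

move-valid : ∀ {m n s} → ValidState m n s → ValidState m n (move m n s)
move-valid {s = st x y dx dy} (vx , vy) = bounce-valid vx , bounce-valid vy

iter-valid : ∀ {m n} k {s} → ValidState m n s → ValidState m n (iter k (move m n) s)
iter-valid zero    vs = vs
iter-valid (suc k) vs = move-valid (iter-valid k vs)

iter-move : ∀ m n k s → iter k (move m n) s ≡
            fromParts (iterate (bounce m) k (xPart s)) (iterate (bounce n) k (yPart s))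
iter-move m n zero    (st x y dx dy) = refl
iter-move m n (suc k) s rewrite iter-move m n k s = refl

rayPeriod : ℕ → ℕ → ℕ
rayPeriod m n = (suc m + suc m) * (suc n + suc n)

ray-periodic : ∀ {m n s} → ValidState m n s → iter (rayPeriod m n) (move m n) s ≡ s
ray-periodic {m} {n} {s = st x y dx dy} (vx , vy) rewrite iter-move m n (rayPeriod m n) (st x y dx dy) =
  cong₂ fromParts
    (subst (λ k → iterate (bounce m) k (x , dx) ≡ (x , dx)) (*-comm (suc n + suc n) (suc m + suc m))
           (iterate-*-fixed (bounce m) (suc n + suc n) (suc m + suc m) _ (bounce-periodic vx)))
    (iterate-*-fixed (bounce n) (suc m + suc m) (suc n + suc n) _ (bounce-periodic vy))

reverse : State → State
reverse (st x y dx dy) = st (stepC dx x) (stepC dy y) (not dx) (not dy)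

-- A ray arriving along the reverse of s leaves along turn s.
turn : ℕ → ℕ → State → State
turn m n (st x y dx dy) = st x y (turnDir (suc m) x dx) (turnDir (suc n) y dy)

segOf-reverse : ∀ s → segOf (reverse s) ≡ segOf s
segOf-reverse (st x y true  true)  = refl
segOf-reverse (st x y true  false) = refl
segOf-reverse (st x y false true)  = refl
segOf-reverse (st x y false false) = refl

reverse-involutive : ∀ {m n s} → ValidState m n s → reverse (reverse s) ≡ s
reverse-involutive {s = st x y dx dy} (vx , vy)
  rewrite stepC-inverse vx | stepC-inverse vy | not-involutive dx | not-involutive dy = refl

move-reverse : ∀ {m n s} → ValidState m n s → move m n (reverse s) ≡ turn m n s
move-reverse {s = st x y dx dy} (vx , vy) rewrite stepC-inverse vx | stepC-inverse vy = refl

turn-move : ∀ {m n s} → ValidState m n s → turn m n (move m n s) ≡ reverse s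
turn-move {s = st x y dx dy} (vx , vy) rewrite turnDir-bounce vx | turnDir-bounce vy = refl

move-reverse-move : ∀ {m n s} → ValidState m n s → move m n (reverse (move m n s)) ≡ reverse s
move-reverse-move vs = trans (move-reverse (move-valid vs)) (turn-move vs)

turn-valid : ∀ {m n s} → ValidState m n s → ValidState m n (turn m n s)
turn-valid {s = st x y dx dy} (vx , vy) = turnDir-valid vx , turnDir-valid vy

turn-involutive : ∀ {m n s} → ValidState m n s → turn m n (turn m n s) ≡ s
turn-involutive {s = st x y dx dy} (vx , vy) rewrite turnDir-involutive vx | turnDir-involutive vy = refl

type-flipˡ : ∀ a b → not (a xor b) ≢ not (not a xor b)
type-flipˡ true  true  ()
type-flipˡ true  false ()
type-flipˡ false true  ()
type-flipˡ false false ()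

type-flipʳ : ∀ a b → not (a xor b) ≢ not (a xor not b)
type-flipʳ true  true  ()
type-flipʳ true  false ()
type-flipʳ false true  ()
type-flipʳ false false ()

segOf-injective : ∀ {m n s t} → ValidState m n s → ValidState m n t → segOf s ≡ segOf t →
                  t ≡ s ⊎ t ≡ reverse s
segOf-injective {s = st x y dx dy} {st x′ y′ dx′ dy′} (vx , vy) (vx′ , vy′) eq
  with lowEnd-injective vx vx′ (cong proj₁ eq) | lowEnd-injective vy vy′ (cong (proj₁ ∘ proj₂) eq)
... | inj₁ refl | inj₁ refl = inj₁ refl
... | inj₂ refl | inj₂ refl = inj₂ refl
... | inj₁ refl | inj₂ refl = contradiction (cong (proj₂ ∘ proj₂) eq) (type-flipʳ dx dy)
... | inj₂ refl | inj₁ refl = contradiction (cong (proj₂ ∘ proj₂) eq) (type-flipˡ dx dy)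

move-moves : ∀ {m n s} → ValidState m n s → posOf (move m n s) ≢ posOf s
move-moves (vx , _) = stepC-moves vx ∘ cong proj₁

reverse-≢ : ∀ {m n s} → ValidState m n s → s ≢ reverse s
reverse-≢ (vx , _) eq = stepC-moves vx (sym (cong (proj₁ ∘ xPart) eq))

reverses-at-corner : ∀ m n s → move m n s ≡ reverse s → IsCorner m n (posOf (move m n s))
reverses-at-corner m n (st x y dx dy) eq =
  reflectDir-flip (suc m) _ dx (cong State.dx eq) , reflectDir-flip (suc n) _ dy (cong State.dy eq)

touches-end : ∀ m n s → Touches (posOf (move m n s)) (segOf s)
touches-end m n (st x y true  true)  = inj₂ refl
touches-end m n (st x y true  false) = inj₁ refl
touches-end m n (st x y false true)  = inj₂ refl
touches-end m n (st x y false false) = inj₁ refl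

-- Loops

first-hit : (Q : ℕ → Set) → (∀ i → Dec (Q i)) → ∀ p → Q (suc p) →
            ∃ λ j → Q (suc j) × (∀ i → 1 ≤ i → i ≤ j → ¬ Q i)
first-hit Q Q? p q = search p 0 (λ { _ (s≤s _) () }) (subst (Q ∘ suc) (sym (+-identityʳ p)) q)
  where
  search : ∀ r j → (∀ i → 1 ≤ i → i ≤ j → ¬ Q i) → Q (suc (r + j)) →
           ∃ λ j → Q (suc j) × (∀ i → 1 ≤ i → i ≤ j → ¬ Q i)
  search zero    j none q = j , q , none
  search (suc r) j none q with Q? (suc j)
  ... | yes q′ = j , q′ , none
  ... | no ¬q′ = search r (suc j) none′ (subst (Q ∘ suc) (sym (+-suc r j)) q)
    where
    none′ : ∀ i → 1 ≤ i → i ≤ suc j → ¬ Q i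
    none′ i 1≤i i≤1+j with m≤n⇒m<n∨m≡n i≤1+j
    ... | inj₁ i<1+j = none i 1≤i (≤-pred i<1+j)
    ... | inj₂ refl  = ¬q′

start : Point → Dir → State
start (x , y) (e , f) = st x y e f

record Loop (m n : ℕ) (v : Point) (d : Dir) : Set where
  constructor mkLoop
  field
    last    : ℕ
    alive   : Alive m n v d last
    returns : posAt m n v d (suc last) ≡ v

isCorner? : ∀ m n p → Dec (IsCorner m n p)
isCorner? m n (x , y) = ((x ≟ 0) ⊎-dec (x ≟ suc m)) ×-dec ((y ≟ 0) ⊎-dec (y ≟ suc n))

Stopped : ℕ → ℕ → Point → Dir → ℕ → Set
Stopped m n v d i = IsCorner m n (posAt m n v d i) ⊎ posAt m n v d i ≡ v

alive-until-stop : ∀ {m n v d j} → (∀ i → 1 ≤ i → i ≤ j → ¬ Stopped m n v d i) → Alive m n v d j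
alive-until-stop none i 1≤i i≤j = none i 1≤i i≤j ∘ inj₁ , none i 1≤i i≤j ∘ inj₂

_≟ₚ_ : (p q : Point) → Dec (p ≡ q)
_≟ₚ_ = ≡-dec _≟_ _≟_

ray-stops : ∀ {m n} v d → ValidState m n (start v d) → Loop m n v d ⊎ ReachesCorner m n v d
ray-stops {m} {n} v d vs
  with first-hit (Stopped m n v d) (λ i → isCorner? m n _ ⊎-dec _ ≟ₚ v)
                (pred (rayPeriod m n)) (inj₂ (cong posOf (ray-periodic vs)))
... | j , inj₁ corner , none = inj₂ (j , alive-until-stop none , corner)
... | j , inj₂ back   , none = inj₁ (mkLoop j (alive-until-stop none) back)

even-or-odd : ∀ k → ∃ λ i → k ≡ i + i ⊎ k ≡ suc (i + i)
even-or-odd zero    = 0 , inj₁ refl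
even-or-odd (suc k) with even-or-odd k
... | i , inj₁ refl = i , inj₂ refl
... | i , inj₂ refl = suc i , inj₁ (cong suc (sym (+-suc i i)))

_≟ₛ_ : (s t : Seg) → Dec (s ≡ t)
_≟ₛ_ = ≡-dec _≟_ (≡-dec _≟_ Bool._≟_)

module LoopFacts {m n : ℕ} {v : Point} {d : Dir} (vs : ValidState m n (start v d)) (L : Loop m n v d) where

  open Loop L

  state : ℕ → State
  state = stateAt m n v d

  OnLoop : Seg → Set
  OnLoop = InRay m n v d

  alive-bound : ∀ {k} → Alive m n v d k → k ≤ last
  alive-bound {k} al with ≤-<-connex k last
  ... | inj₁ k≤last = k≤last
  ... | inj₂ last<k = contradiction returns (proj₂ (al (suc last) (s≤s z≤n) last<k))

  alive-upto : ∀ {k} → k ≤ last → Alive m n v d k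
  alive-upto k≤last i 1≤i i≤k = alive i 1≤i (≤-trans i≤k k≤last)

  onLoop : ∀ {k} → k ≤ last → OnLoop (segOf (state k))
  onLoop k≤last = _ , alive-upto k≤last , refl

  onLoop? : ∀ s → Dec (OnLoop s)
  onLoop? s = map′ (λ (k , k<1+last , eq) → k , alive-upto (≤-pred k<1+last) , eq)
                   (λ (k , al , eq) → k , s≤s (alive-bound al) , eq)
                   (anyUpTo? (λ k → segOf (state k) ≟ₛ s) (suc last))

  Passes : State → Set
  Passes ℓ = posOf ℓ ≡ v ⊎ (¬ IsCorner m n (posOf ℓ) × OnLoop (segOf (turn m n ℓ)))

  departing : ∀ {ℓ} k → k ≤ last → state k ≡ ℓ → Passes ℓ
  departing zero    _      refl = inj₁ refl
  departing (suc j) j<last refl =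
    inj₂ (proj₁ (alive (suc j) (s≤s z≤n) j<last) , subst OnLoop previous (onLoop (<⇒≤ j<last)))
    where
    previous : segOf (state j) ≡ segOf (turn m n (state (suc j)))
    previous = trans (sym (segOf-reverse (state j))) (cong segOf (sym (turn-move (iter-valid j vs))))

  arriving : ∀ {ℓ} k → k ≤ last → state (suc k) ≡ turn m n ℓ → Passes ℓ
  arriving k k≤last next with m≤n⇒m<n∨m≡n k≤last
  ... | inj₁ k<last = inj₂ (subst (¬_ ∘ IsCorner m n ∘ posOf) next (proj₁ (alive (suc k) (s≤s z≤n) k<last))
                         , subst (OnLoop ∘ segOf) next (onLoop k<last))
  ... | inj₂ refl   = inj₁ (trans (cong posOf (sym next)) returns)

  passes-through : ∀ {ℓ} → ValidState m n ℓ → OnLoop (segOf ℓ) → Passes ℓ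
  passes-through vℓ (k , al , eq) with segOf-injective vℓ (iter-valid k vs) (sym eq)
  ... | inj₁ departs = departing k (alive-bound al) departs
  ... | inj₂ arrives = arriving k (alive-bound al) (trans (cong (move m n) arrives) (move-reverse vℓ))

  at-v-only-initially : ∀ k → k ≤ last → posOf (state k) ≡ v → k ≡ 0
  at-v-only-initially zero    _      _   = refl
  at-v-only-initially (suc k) k<last atv = contradiction atv (proj₂ (alive (suc k) (s≤s z≤n) k<last))

  touches-last : Touches v (segOf (state last))
  touches-last = subst (λ p → Touches p (segOf (state last))) returns (touches-end m n (state last))

  arrival : ∀ {g} → ValidState m n (start v g) → segOf (state last) ≡ segOf (start v g) →
            state last ≡ reverse (start v g)
  arrival vg eq with segOf-injective vg (iter-valid last vs) (sym eq)
  ... | inj₂ arrives = arrives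
  ... | inj₁ at-v    =
    contradiction (trans (cong (posOf ∘ move m n ∘ state) (sym last≡0)) returns) (move-moves vs)
    where
    last≡0 : last ≡ 0
    last≡0 = at-v-only-initially last ≤-refl (cong posOf at-v)

  module Retrace {g : Dir} (vg : ValidState m n (start v g)) (arrives : state last ≡ reverse (start v g)) where

    retrace : ∀ j l → j + l ≡ last → stateAt m n v g j ≡ reverse (state l)
    retrace zero    l refl = trans (sym (reverse-involutive vg)) (cong reverse (sym arrives))
    retrace (suc j) l e    = trans (cong (move m n) (retrace j (suc l) (trans (+-suc j l) e)))
                                   (move-reverse-move (iter-valid l vs))

    reversed : Loop m n v g
    reversed = mkLoop last alive′ returns′
      where
      alive′ : Alive m n v g last
      alive′ i 1≤i i≤last =
        subst (λ p → ¬ IsCorner m n p × p ≢ v)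
              (sym (cong posOf (retrace i (last ∸ i) (m+[n∸m]≡n i≤last))))
              (alive (suc (last ∸ i)) (s≤s z≤n) (∸-monoʳ-< 1≤i i≤last))
      returns′ : posAt m n v g (suc last) ≡ v
      returns′ = trans (cong (posOf ∘ move m n) (retrace last 0 (+-identityʳ last))) (cong posOf (move-reverse vs))

  no-retrace : segOf (state last) ≢ segOf (start v d)
  no-retrace same with even-or-odd last
  ... | i , inj₁ e = reverse-≢ (iter-valid i vs) (retrace i i (sym e))
    where open Retrace vs (arrival vs same)
  ... | i , inj₂ e = proj₁ (alive (suc i) (s≤s z≤n) (subst (suc i ≤_) (sym e) (s≤s (m≤m+n i i))))
                           (reverses-at-corner m n (state i) (retrace (suc i) i (sym e)))
    where open Retrace vs (arrival vs same)

record Continues (m n : ℕ) (v : Point) (T : Seg → Set) : Set where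
  field
    continues : ∀ {ℓ} → ValidState m n ℓ → posOf ℓ ≢ v → T (segOf ℓ) → T (segOf (turn m n ℓ))
    avoids-corners : ∀ {ℓ} → ValidState m n ℓ → IsCorner m n (posOf ℓ) → ¬ T (segOf ℓ)

module _ {m n : ℕ} {v : Point} {T₁ T₂ : Seg → Set} where
  open Continues

  Continues-⊎ : Continues m n v T₁ → Continues m n v T₂ → Continues m n v (λ s → T₁ s ⊎ T₂ s)
  Continues-⊎ c₁ c₂ .continues vℓ ℓ≢v (inj₁ t) = inj₁ (continues c₁ vℓ ℓ≢v t)
  Continues-⊎ c₁ c₂ .continues vℓ ℓ≢v (inj₂ t) = inj₂ (continues c₂ vℓ ℓ≢v t)
  Continues-⊎ c₁ c₂ .avoids-corners vℓ c (inj₁ t) = avoids-corners c₁ vℓ c t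
  Continues-⊎ c₁ c₂ .avoids-corners vℓ c (inj₂ t) = avoids-corners c₂ vℓ c t

loop-continues : ∀ {m n v d} → ¬ IsCorner m n v → (vs : ValidState m n (start v d)) (L : Loop m n v d) →
                 Continues m n v (InRay m n v d)
loop-continues {m} {n} {v} v-inner vs L = record { continues = through ; avoids-corners = avoids }
  where
  open LoopFacts vs L

  through : ∀ {ℓ} → ValidState m n ℓ → posOf ℓ ≢ v → OnLoop (segOf ℓ) → OnLoop (segOf (turn m n ℓ))
  through vℓ ℓ≢v t with passes-through vℓ t
  ... | inj₁ ℓ≡v     = contradiction ℓ≡v ℓ≢v
  ... | inj₂ (_ , t′) = t′

  avoids : ∀ {ℓ} → ValidState m n ℓ → IsCorner m n (posOf ℓ) → ¬ OnLoop (segOf ℓ)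
  avoids vℓ c t with passes-through vℓ t
  ... | inj₁ ℓ≡v      = v-inner (subst (IsCorner m n) ℓ≡v c)
  ... | inj₂ (¬c , _) = ¬c c

-- Labelings of balanced sets of diagonals

xor-cancelʳ : ∀ x y → (x xor y) xor y ≡ x
xor-cancelʳ x y = trans (xor-assoc x y y) (trans (cong (x xor_) (xor-same y)) (xor-identityʳ x))

-- Parity conditions at the lattice points of R: at every point an even number of the chosen
-- diagonals meet.  The condition at the corner (m+1, n+1) follows from the others.
record Balanced (m n : ℕ) (χ : Seg → Bool) : Set where
  field
    at-interior : ∀ a b → suc a ≤ m → suc b ≤ n →
                  χ (a , b , true) xor χ (a , suc b , false) ≡ χ (suc a , b , false) xor χ (suc a , suc b , true)
    at-bottom   : ∀ a → suc a ≤ m → χ (a , 0 , false) ≡ χ (suc a , 0 , true)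
    at-left     : ∀ b → suc b ≤ n → χ (0 , suc b , true) ≡ χ (0 , b , false)
    at-top      : ∀ a → suc a ≤ m → χ (a , n , true) ≡ χ (suc a , n , false)
    at-right    : ∀ b → suc b ≤ n → χ (m , suc b , false) ≡ χ (m , b , true)
    at-corner₀₀ : χ (0 , 0 , true) ≡ false
    at-corner₀ₙ : χ (0 , n , false) ≡ false
    at-cornerₘ₀ : χ (m , 0 , false) ≡ false

module Labeling {m n : ℕ} (T : Seg → Set) (T? : ∀ s → Dec (T s)) (balanced : Balanced m n (does ∘ T?)) where

  open Balanced balanced

  χ : Seg → Bool
  χ = does ∘ T?

  M A : ℕ → ℕ → Bool
  M a b = χ (a , b , true)
  A a b = χ (a , b , false)

  -- label of the south triangle of the square (a, b): parity of the diagonals crossed below it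
  base : ℕ → ℕ → Bool
  base a zero    = false
  base a (suc b) = base a b xor (A a b xor M a b)

  label : Tri → Bool
  label (a , b , south) = base a b
  label (a , b , east)  = base a b xor A a b
  label (a , b , west)  = base a b xor M a b
  label (a , b , north) = base a b xor (A a b xor M a b)

  crossing : ∀ a b {s t d} → HalfDiag s t d → label (a , b , t) ≡ label (a , b , s) xor χ (a , b , d)
  crossing a b se = refl
  crossing a b es = sym (xor-cancelʳ (base a b) (A a b))
  crossing a b en = sym (xor-assoc (base a b) (A a b) (M a b))
  crossing a b ne = sym (trans (cong (_xor M a b) (sym (xor-assoc (base a b) (A a b) (M a b))))
                               (xor-cancelʳ (base a b xor A a b) (M a b)))
  crossing a b nw = sym (trans (cong (λ z → (base a b xor z) xor A a b) (xor-comm (A a b) (M a b)))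
                        (trans (cong (_xor A a b) (sym (xor-assoc (base a b) (M a b) (A a b))))
                               (xor-cancelʳ (base a b xor M a b) (A a b))))
  crossing a b wn = trans (cong (base a b xor_) (xor-comm (A a b) (M a b))) (sym (xor-assoc (base a b) (M a b) (A a b)))
  crossing a b ws = sym (xor-cancelʳ (base a b) (M a b))
  crossing a b sw = refl

  east≡west : ∀ a b → suc a ≤ m → b ≤ n → label (a , b , east) ≡ label (suc a , b , west)
  east≡west a zero    a<m _   = at-bottom a a<m
  east≡west a (suc b) a<m b<n = begin
    (S xor (A a b xor M a b)) xor A a (suc b)   ≡⟨ cong (_xor A a (suc b)) (sym (xor-assoc S (A a b) (M a b))) ⟩
    ((S xor A a b) xor M a b) xor A a (suc b)   ≡⟨ xor-assoc (S xor A a b) (M a b) (A a (suc b)) ⟩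
    (S xor A a b) xor (M a b xor A a (suc b))   ≡⟨ cong₂ _xor_ (east≡west a b a<m (<⇒≤ b<n)) (at-interior a b a<m b<n) ⟩
    (S′ xor M′) xor (A′ xor M (suc a) (suc b))   ≡⟨ sym (xor-assoc (S′ xor M′) A′ (M (suc a) (suc b))) ⟩
    ((S′ xor M′) xor A′) xor M (suc a) (suc b)   ≡⟨ cong (_xor M (suc a) (suc b)) (xor-assoc S′ M′ A′) ⟩
    (S′ xor (M′ xor A′)) xor M (suc a) (suc b)   ≡⟨ cong (λ z → (S′ xor z) xor M (suc a) (suc b)) (xor-comm M′ A′) ⟩
    (S′ xor (A′ xor M′)) xor M (suc a) (suc b)   ∎
    where
    open ≡-Reasoning
    S = base a b
    S′ = base (suc a) b
    A′ = A (suc a) b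
    M′ = M (suc a) b

  west-edge : ∀ b → b ≤ n → label (0 , b , west) ≡ false
  west-edge zero    _   = at-corner₀₀
  west-edge (suc b) b<n = begin
    (S xor (A 0 b xor M 0 b)) xor M 0 (suc b) ≡⟨ cong ((S xor (A 0 b xor M 0 b)) xor_) (at-left b b<n) ⟩
    (S xor (A 0 b xor M 0 b)) xor A 0 b       ≡⟨ cong (λ z → (S xor z) xor A 0 b) (xor-comm (A 0 b) (M 0 b)) ⟩
    (S xor (M 0 b xor A 0 b)) xor A 0 b       ≡⟨ cong (_xor A 0 b) (sym (xor-assoc S (M 0 b) (A 0 b))) ⟩
    ((S xor M 0 b) xor A 0 b) xor A 0 b       ≡⟨ xor-cancelʳ (S xor M 0 b) (A 0 b) ⟩
    S xor M 0 b                               ≡⟨ west-edge b (<⇒≤ b<n) ⟩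
    false                                     ∎
    where
    open ≡-Reasoning
    S = base 0 b

  east-edge : ∀ b → b ≤ n → label (m , b , east) ≡ false
  east-edge zero    _   = at-cornerₘ₀
  east-edge (suc b) b<n = begin
    (S xor (A m b xor M m b)) xor A m (suc b) ≡⟨ cong ((S xor (A m b xor M m b)) xor_) (at-right b b<n) ⟩
    (S xor (A m b xor M m b)) xor M m b       ≡⟨ cong (_xor M m b) (sym (xor-assoc S (A m b) (M m b))) ⟩
    ((S xor A m b) xor M m b) xor M m b       ≡⟨ xor-cancelʳ (S xor A m b) (M m b) ⟩
    S xor A m b                               ≡⟨ east-edge b (<⇒≤ b<n) ⟩
    false                                     ∎
    where
    open ≡-Reasoning
    S = base m b

  north-edge : ∀ a → a ≤ m → label (a , n , north) ≡ false
  north-edge zero    _   = trans (cong (λ z → base 0 n xor (z xor M 0 n)) at-corner₀ₙ) (west-edge n ≤-refl)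
  north-edge (suc a) a<m = begin
    S′ xor (A′ xor M′)            ≡⟨ cong (S′ xor_) (xor-comm A′ M′) ⟩
    S′ xor (M′ xor A′)            ≡⟨ sym (xor-assoc S′ M′ A′) ⟩
    (S′ xor M′) xor A′            ≡⟨ cong₂ _xor_ (sym (east≡west a n a<m ≤-refl)) (sym (at-top a a<m)) ⟩
    (S xor A a n) xor M a n       ≡⟨ xor-assoc S (A a n) (M a n) ⟩
    S xor (A a n xor M a n)       ≡⟨ north-edge a (<⇒≤ a<m) ⟩
    false                         ∎
    where
    open ≡-Reasoning
    S = base a n
    S′ = base (suc a) n
    A′ = A (suc a) n
    M′ = M (suc a) n

  free-preserves : ∀ {t u} → Free m n T t u → label t ≡ label u
  free-preserves (inner {a} {b} {s} {d = d} _ _ hd ¬T) =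
    sym (trans (crossing a b hd) (trans (cong (label (a , b , s) xor_) (dec-false (T? (a , b , d)) ¬T))
                                        (xor-identityʳ (label (a , b , s)))))
  free-preserves (up _ _)                = refl
  free-preserves (down _ _)              = refl
  free-preserves (right {a} {b} a<m b≤n) = east≡west a b a<m b≤n
  free-preserves (left {a} {b} a<m b≤n)  = sym (east≡west a b a<m b≤n)

  region-preserves : ∀ {t u} → SameRegion m n T t u → label t ≡ label u
  region-preserves ε        = refl
  region-preserves (f ◅ fs) = trans (free-preserves f) (region-preserves fs)

  cut-flips : ∀ {t u} → Cut m n T t u → label t ≢ label u
  cut-flips (cut {a} {b} {s} {t} {d} _ _ hd onT) eq = not-¬ refl (begin
    label (a , b , s)                    ≡⟨ eq ⟩
    label (a , b , t)                    ≡⟨ crossing a b hd ⟩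
    label (a , b , s) xor χ (a , b , d)  ≡⟨ cong (label (a , b , s) xor_) (dec-true (T? (a , b , d)) onT) ⟩
    label (a , b , s) xor true           ≡⟨ xor-comm (label (a , b , s)) true ⟩
    not (label (a , b , s))              ∎)
    where open ≡-Reasoning

  boundary-negative : ∀ u → ValidTri m n u → OnBoundary m n u → label u ≡ false
  boundary-negative (a , b , south) _          refl = refl
  boundary-negative (a , b , north) (a≤m , _)  refl = north-edge a a≤m
  boundary-negative (a , b , west)  (_ , b≤n)  refl = west-edge b b≤n
  boundary-negative (a , b , east)  (_ , b≤n)  refl = east-edge b b≤n

  proper : ProperNegativeLabeling m n T label
  proper = (λ _ _ → region-preserves) , (λ _ _ c _ → cut-flips c) ,
           λ { _ _ (u , valid , edge , path) → trans (region-preserves path) (boundary-negative u valid edge) }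

-- Parity at the vertex of a right-angled trail

exactly-one : ∀ {A : Set} {P : A → Set} (P? : ∀ a → Dec (P a)) {x y s o : A} →
              x ≢ y → s ≡ x ⊎ s ≡ y → P s → o ≢ x → o ≢ y →
              (∀ u → P u → u ≡ x ⊎ u ≡ y → u ≡ s ⊎ u ≡ o) → does (P? x) ≡ not (does (P? y))
exactly-one {P = P} P? {x} {y} x≢y (inj₁ refl) Ps o≢x o≢y only =
  trans (dec-true (P? x) Ps) (cong not (sym (dec-false (P? y) ¬Py)))
  where
  ¬Py : ¬ P y
  ¬Py Py = [ x≢y ∘ sym , o≢y ∘ sym ]′ (only y Py (inj₂ refl))
exactly-one {P = P} P? {x} {y} x≢y (inj₂ refl) Ps o≢x o≢y only =
  trans (dec-false (P? x) ¬Px) (cong not (sym (dec-true (P? y) Ps)))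
  where
  ¬Px : ¬ P x
  ¬Px Px = [ x≢y , o≢x ∘ sym ]′ (only x Px (inj₁ refl))

module _ {a₀ b₀ : ℕ} where

  private
    v : Point
    v = suc a₀ , suc b₀

  touching-main : ∀ {x y} → Touches v (x , y , true) →
                  (x , y , true) ≡ (a₀ , b₀ , true) ⊎ (x , y , true) ≡ (suc a₀ , suc b₀ , true)
  touching-main (inj₁ refl) = inj₂ refl
  touching-main (inj₂ refl) = inj₁ refl

  touching-anti : ∀ {x y} → Touches v (x , y , false) →
                  (x , y , false) ≡ (a₀ , suc b₀ , false) ⊎ (x , y , false) ≡ (suc a₀ , b₀ , false)
  touching-anti (inj₁ refl) = inj₁ refl
  touching-anti (inj₂ refl) = inj₂ refl

  main-touches : ∀ {s} → s ≡ (a₀ , b₀ , true) ⊎ s ≡ (suc a₀ , suc b₀ , true) → Touches v s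
  main-touches (inj₁ refl) = inj₂ refl
  main-touches (inj₂ refl) = inj₁ refl

  anti-touches : ∀ {s} → s ≡ (a₀ , suc b₀ , false) ⊎ s ≡ (suc a₀ , b₀ , false) → Touches v s
  anti-touches (inj₁ refl) = inj₁ refl
  anti-touches (inj₂ refl) = inj₂ refl

  VertexParity : {T : Seg → Set} → (∀ s → Dec (T s)) → Set
  VertexParity T? = does (T? (a₀ , b₀ , true)) ≡ not (does (T? (suc a₀ , suc b₀ , true))) ×
                    does (T? (a₀ , suc b₀ , false)) ≡ not (does (T? (suc a₀ , b₀ , false)))

  right-angle-parity : ∀ {T : Seg → Set} (T? : ∀ s → Dec (T s)) {x y x′ y′} →
    T (x , y , true) → Touches v (x , y , true) → T (x′ , y′ , false) → Touches v (x′ , y′ , false) →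
    (∀ s → T s → Touches v s → s ≡ (x , y , true) ⊎ s ≡ (x′ , y′ , false)) → VertexParity T?
  right-angle-parity T? Tm tm Ta ta only =
    exactly-one T? (λ ()) (touching-main tm) Tm (λ ()) (λ ()) (λ u Tu → only u Tu ∘ main-touches) ,
    exactly-one T? (λ ()) (touching-anti ta) Ta (λ ()) (λ ()) (λ u Tu → swap ∘ only u Tu ∘ anti-touches)

  ninety-degree-parity : ∀ {T : Seg → Set} (T? : ∀ s → Dec (T s)) (s₁ s₂ : Seg) →
    proj₂ (proj₂ s₁) ≢ proj₂ (proj₂ s₂) → T s₁ → Touches v s₁ → T s₂ → Touches v s₂ →
    (∀ s → T s → Touches v s → s ≡ s₁ ⊎ s ≡ s₂) → VertexParity T?
  ninety-degree-parity T? (_ , _ , true)  (_ , _ , false) _  T₁ t₁ T₂ t₂ only =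
    right-angle-parity T? T₁ t₁ T₂ t₂ only
  ninety-degree-parity T? (_ , _ , false) (_ , _ , true)  _  T₁ t₁ T₂ t₂ only =
    right-angle-parity T? T₂ t₂ T₁ t₁ (λ s Ts → swap ∘ only s Ts)
  ninety-degree-parity T? (_ , _ , true)  (_ , _ , true)  ty _ _ _ _ _ = contradiction refl ty
  ninety-degree-parity T? (_ , _ , false) (_ , _ , false) ty _ _ _ _ _ = contradiction refl ty

module BalancedTrail {m n a₀ b₀ : ℕ} (a₀<m : suc a₀ ≤ m) (b₀<n : suc b₀ ≤ n)
  (T : Seg → Set) (T? : ∀ s → Dec (T s)) (cont : Continues m n (suc a₀ , suc b₀) T)
  (parity : VertexParity {a₀} {b₀} T?)
  where

  open Continues cont

  χ : Seg → Bool
  χ = does ∘ T?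

  paired : ∀ {ℓ} → ValidState m n ℓ → posOf ℓ ≢ (suc a₀ , suc b₀) → χ (segOf ℓ) ≡ χ (segOf (turn m n ℓ))
  paired vℓ ℓ≢v = does-⇔ (mk⇔ (continues vℓ ℓ≢v)
                              (subst (T ∘ segOf) (turn-involutive vℓ) ∘ continues (turn-valid vℓ) ℓ≢v))
                         (T? _) (T? _)

  paired-at : ∀ {x y dx dy dx′ dy′} → ValidState m n (st x y dx dy) → (x , y) ≢ (suc a₀ , suc b₀) →
              turnDir (suc m) x dx ≡ dx′ → turnDir (suc n) y dy ≡ dy′ →
              χ (segOf (st x y dx dy)) ≡ χ (segOf (st x y dx′ dy′))
  paired-at vℓ ℓ≢v refl refl = paired vℓ ℓ≢v

  empty-at-corner : ∀ {ℓ} → ValidState m n ℓ → IsCorner m n (posOf ℓ) → χ (segOf ℓ) ≡ false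
  empty-at-corner vℓ c = dec-false (T? _) (avoids-corners vℓ c)

  interior-parity : ∀ a b → suc a ≤ m → suc b ≤ n →
                    χ (a , b , true) xor χ (a , suc b , false) ≡ χ (suc a , b , false) xor χ (suc a , suc b , true)
  interior-parity a b a<m b<n with (suc a , suc b) ≟ₚ (suc a₀ , suc b₀)
  ... | yes refl = begin
    χ (a , b , true) xor χ (a , suc b , false) ≡⟨ cong₂ _xor_ (proj₁ parity) (proj₂ parity) ⟩
    not M₁ xor not A₁                          ≡⟨ xor-annihilates-not M₁ A₁ ⟩
    M₁ xor A₁                                  ≡⟨ xor-comm M₁ A₁ ⟩
    A₁ xor M₁                                  ∎
    where
    open ≡-Reasoning
    M₁ A₁ : Bool
    M₁ = χ (suc a , suc b , true)
    A₁ = χ (suc a , b , false)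
  ... | no p≢v = trans (cong₂ _xor_ (sym straight) across) (xor-comm (χ (suc a , suc b , true)) (χ (suc a , b , false)))
    where
    straight : χ (suc a , suc b , true) ≡ χ (a , b , true)
    straight = paired-at (up a<m , up b<n) p≢v
                         (reflectDir-inner false (<⇒≢ a<m)) (reflectDir-inner false (<⇒≢ b<n))
    across : χ (a , suc b , false) ≡ χ (suc a , b , false)
    across = paired-at (down (<⇒≤ a<m) , up b<n) p≢v
                       (reflectDir-inner true (<⇒≢ a<m)) (reflectDir-inner false (<⇒≢ b<n))

  balanced : Balanced m n χ
  balanced = record
    { at-interior = interior-parity
    ; at-bottom   = λ a a<m → sym (paired-at (up a<m , up z≤n) (λ ()) (reflectDir-inner false (<⇒≢ a<m)) refl)
    ; at-left     = λ b b<n → paired-at (up z≤n , up b<n) (λ ()) refl (reflectDir-inner false (<⇒≢ b<n))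
    ; at-top      = λ a a<m → paired-at (down (<⇒≤ a<m) , down ≤-refl)
                                        (λ eq → <⇒≢ b₀<n (suc-injective (cong proj₂ (sym eq))))
                                        (reflectDir-inner true (<⇒≢ a<m)) (reflectDir-top n true)
    ; at-right    = λ b b<n → paired-at (down ≤-refl , up b<n)
                                        (λ eq → <⇒≢ a₀<m (suc-injective (cong proj₁ (sym eq))))
                                        (reflectDir-top m true) (reflectDir-inner false (<⇒≢ b<n))
    ; at-corner₀₀ = empty-at-corner {st 0 0 true true} (up z≤n , up z≤n) (inj₁ refl , inj₁ refl)
    ; at-corner₀ₙ = empty-at-corner {st 0 (suc n) true false} (up z≤n , down ≤-refl) (inj₁ refl , inj₂ refl)
    ; at-cornerₘ₀ = empty-at-corner {st (suc m) 0 false true} (down ≤-refl , up z≤n) (inj₂ refl , inj₁ refl)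
    }

-- Closed 90-degree trails

pigeonhole : ∀ {A : Set} {a b x y z : A} → x ≡ a ⊎ x ≡ b → y ≡ a ⊎ y ≡ b → z ≡ a ⊎ z ≡ b →
             y ≢ z → x ≢ y → x ≡ z
pigeonhole (inj₁ refl) (inj₁ refl) _           _   x≢y = contradiction refl x≢y
pigeonhole (inj₁ refl) (inj₂ refl) (inj₁ refl) _   _   = refl
pigeonhole (inj₁ refl) (inj₂ refl) (inj₂ refl) y≢z _   = contradiction refl y≢z
pigeonhole (inj₂ refl) (inj₂ refl) _           _   x≢y = contradiction refl x≢y
pigeonhole (inj₂ refl) (inj₁ refl) (inj₂ refl) _   _   = refl
pigeonhole (inj₂ refl) (inj₁ refl) (inj₁ refl) y≢z _   = contradiction refl y≢z

valid-interior : ∀ {m x} → suc x ≤ m → ∀ e → Valid m (suc x , e)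
valid-interior x<m true  = up x<m
valid-interior x<m false = down (<⇒≤ x<m)

RayLoops : ℕ → ℕ → Point → TrailSpec → Set
RayLoops m n v (oneRay d)         = Loop m n v d
RayLoops m n v (twoRays d₁ d₂ _)  = Loop m n v d₁ × Loop m n v d₂

module InteriorVertex {m n a₀ b₀ : ℕ} (a₀<m : suc a₀ ≤ m) (b₀<n : suc b₀ ≤ n) where

  v : Point
  v = suc a₀ , suc b₀

  valid : ∀ d → ValidState m n (start v d)
  valid (e , f) = valid-interior a₀<m e , valid-interior b₀<n f

  v-inner : ¬ IsCorner m n v
  v-inner (inj₁ () , _)
  v-inner (inj₂ eq , _) = <⇒≢ a₀<m (suc-injective eq)

  first-on-ray : ∀ d → InRay m n v d (segOf (start v d))
  first-on-ray d = 0 , (λ { _ (s≤s _) () }) , refl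

  touches-first : ∀ d → Touches v (segOf (start v d))
  touches-first (true  , true)  = inj₁ refl
  touches-first (true  , false) = inj₂ refl
  touches-first (false , true)  = inj₁ refl
  touches-first (false , false) = inj₂ refl

  touching-leg : ∀ {s} → Touches v s → ∃ λ g → s ≡ segOf (start v g)
  touching-leg {_ , _ , true}  (inj₁ refl) = (true , true) , refl
  touching-leg {_ , _ , true}  (inj₂ refl) = (false , false) , refl
  touching-leg {_ , _ , false} (inj₁ refl) = (false , true) , refl
  touching-leg {_ , _ , false} (inj₂ refl) = (true , false) , refl

  first-segments-differ : ∀ {d d′} → d ≢ d′ → segOf (start v d) ≢ segOf (start v d′)
  first-segments-differ {d} {d′} d≢d′ eq with segOf-injective (valid d) (valid d′) eq
  ... | inj₁ same    = d≢d′ (sym (cong (λ s → State.dx s , State.dy s) same))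
  ... | inj₂ reversed = move-moves (valid d) (sym (cong posOf reversed))

  loop-of-return : ∀ {d s} → InRay m n v d s → Touches v s → s ≢ segOf (start v d) → Loop m n v d
  loop-of-return {d} (k , al , eq) tv s≢first with touching-leg tv
  ... | g , refl with segOf-injective (valid g) (iter-valid k (valid d)) (sym eq)
  ...   | inj₂ arrives = mkLoop k al (cong posOf (trans (cong (move m n) arrives) (move-reverse (valid g))))
  ...   | inj₁ at-v with k
  ...     | zero  = contradiction (cong segOf (sym at-v)) s≢first
  ...     | suc j = contradiction (cong posOf at-v) (proj₂ (al (suc j) (s≤s z≤n) ≤-refl))

  partner-loop : ∀ {d d′ s₁ s₂} → d ≢ d′ →
                 (∀ s → InRay m n v d s ⊎ InRay m n v d′ s → Touches v s → s ≡ s₁ ⊎ s ≡ s₂) →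
                 Loop m n v d → Loop m n v d′
  partner-loop {d} {d′} d≢d′ only L = Retrace.reversed (valid d′) (arrival (valid d′) last≡first′)
    where
    open LoopFacts (valid d) L
    last≡first′ : segOf (state (Loop.last L)) ≡ segOf (start v d′)
    last≡first′ = pigeonhole (only _ (inj₁ (onLoop ≤-refl)) touches-last)
                             (only _ (inj₁ (first-on-ray d)) (touches-first d))
                             (only _ (inj₂ (first-on-ray d′)) (touches-first d′))
                             (first-segments-differ d≢d′) no-retrace

  closed-trail-loops : ∀ τ → ClosedNinetyDegreeTrail m n v τ → RayLoops m n v τ
  closed-trail-loops (oneRay d) ((s₁ , s₂ , s₁≢s₂ , T₁ , t₁ , T₂ , t₂ , only , _) , _)
    with only (segOf (start v d)) (first-on-ray d) (touches-first d)
  ... | inj₁ first≡s₁ = loop-of-return T₂ t₂ (λ s₂≡first → s₁≢s₂ (trans (sym first≡s₁) (sym s₂≡first)))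
  ... | inj₂ first≡s₂ = loop-of-return T₁ t₁ (λ s₁≡first → s₁≢s₂ (trans s₁≡first first≡s₂))
  closed-trail-loops (twoRays d₁ d₂ d₁≢d₂) ((_ , _ , _ , _ , _ , _ , _ , only , _) , not-open)
    with ray-stops v d₁ (valid d₁) | ray-stops v d₂ (valid d₂)
  ... | inj₁ L₁ | _       = L₁ , partner-loop d₁≢d₂ only L₁
  ... | inj₂ _  | inj₁ L₂ = partner-loop (d₁≢d₂ ∘ sym) (λ s → only s ∘ swap) L₂ , L₂
  ... | inj₂ r₁ | inj₂ r₂ = contradiction (r₁ , r₂) not-open

  trail? : ∀ τ → RayLoops m n v τ → ∀ s → Dec (TrailSeg m n v τ s)
  trail? (oneRay d)         L         = LoopFacts.onLoop? (valid d) L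
  trail? (twoRays d₁ d₂ _)  (L₁ , L₂) s =
    LoopFacts.onLoop? (valid d₁) L₁ s ⊎-dec LoopFacts.onLoop? (valid d₂) L₂ s

  trail-continues : ∀ τ → RayLoops m n v τ → Continues m n v (TrailSeg m n v τ)
  trail-continues (oneRay d)        L         = loop-continues v-inner (valid d) L
  trail-continues (twoRays d₁ d₂ _) (L₁ , L₂) =
    Continues-⊎ (loop-continues v-inner (valid d₁) L₁) (loop-continues v-inner (valid d₂) L₂)

lemma2p2 : (m n : ℕ) → 1 ≤ m → 1 ≤ n →
           (vx vy : ℕ) → 1 ≤ vx → vx ≤ m → 1 ≤ vy → vy ≤ n →
           (τ : TrailSpec) → ClosedNinetyDegreeTrail m n (vx , vy) τ →
           ∃ λ (ℓ : Tri → Bool) → ProperNegativeLabeling m n (TrailSeg m n (vx , vy) τ) ℓ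
lemma2p2 m n _ _ zero     _        () _    _  _    _ _
lemma2p2 m n _ _ (suc _)  zero     _  _    () _    _ _
lemma2p2 m n _ _ (suc a₀) (suc b₀) _  a₀<m _  b₀<n τ
         closed@((s₁ , s₂ , _ , T₁ , t₁ , T₂ , t₂ , only , ty) , _) =
  label , proper
  where
  open InteriorVertex a₀<m b₀<n
  loops : RayLoops m n v τ
  loops = closed-trail-loops τ closed
  T? : ∀ s → Dec (TrailSeg m n v τ s)
  T? = trail? τ loops
  open BalancedTrail a₀<m b₀<n (TrailSeg m n v τ) T? (trail-continues τ loops)
                     (ninety-degree-parity T? s₁ s₂ ty T₁ t₁ T₂ t₂ only)
  open Labeling (TrailSeg m n v τ) T? balanced
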